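{- Let $T_1,T_2,T_3,T_4$ be the sets of prime constellations greater than $5$ of the forms $\{p,p+2\}$, $\{p,p+2,p+6\}$, $\{p,p+2,p+6,p+8\}$, $\{p,p+2,p+6,p+8,p+12\}$ respectively (all listed numbers prime, $p>5$). Then every element of every member of $T_1,T_2,T_3,T_4$ lies in some principal Eratosthenes ray $r_{p_0}$, $p_0\in\overline{C}$. Moreover, at most one element of each pair in $T_1$, at most two elements of each triple in $T_2$ and of each quadruple in $T_3$, and at most three elements of each quintuple in $T_4$ fail to be the origin (first element) of a principal ray; equivalently, the remaining elements belong to $P_1=\{\pi^{ -1}(p_0): p_0\in\overline{C}\}$.
   Context: $P$ is the set of primes, $p_1=2<p_2=3<\dots$ its elements, $\pi(p_n)=n$ and $\pi^{ -1}(n)=p_n$. $\overline{C}=\mathbb{N}\setminus P=\{1,4,6,8,9,\ldots\}$. For $p_0\in\mathbb{N}$ the Eratosthenes ray is $r_{p_0}=\{p_{k+1}:k\ge0\}$ with $p_{k+1}=\pi^{ -1}(p_k)$; rays with base in $\overline{C}$ are principal, and the origin of the principal ray $r_{p_0}$ is its first element $\pi^{ -1}(p_0)$. Thus a prime $q$ is an origin of a principal ray iff $\pi(q)\in\overline{C}$. -}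

module Defs where

open import Data.Nat using (ℕ; zero; suc; _≤_; _<_; _+_)
open import Data.Nat.Properties using (_≟_; _≤?_)
open import Data.Nat.Primality using (Prime; prime?)
open import Data.Product using (Σ; _×_; _,_; proj₁; proj₂)
open import Data.List using (List; length; filter)
open import Relation.Nullary using (Dec; yes; no; ¬_; does)

open import Relation.Nullary.Decidable using (_×-dec_; ¬?)
open import Relation.Binary.PropositionalEquality using (_≡_; refl; sym; trans)
open import Data.Bool using (if_then_else_)

-- π(n) : number of primes p with p ≤ n.  For a prime q, π q is its index,
-- i.e. q = p_{π q} with p_1 = 2.
π : ℕ → ℕ
π zero = zero
π (suc n) = if does (prime? (suc n)) then suc (π n) else π n

-- C̄ = ℕ \ P with ℕ = {1,2,3,...}: the non-prime positive integers.
Cbar : ℕ → Set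
Cbar n = (1 ≤ n) × ¬ Prime n

IsInvPi : ℕ → ℕ → Set
IsInvPi n q = Prime q × π q ≡ n

-- Ray p₀ q : q belongs to the Eratosthenes ray r_{p₀} = {p_{k+1} : k ≥ 0},
-- where p_{k+1} = π⁻¹(p_k).
data Ray (p₀ : ℕ) : ℕ → Set where
  first : ∀ {q} → IsInvPi p₀ q → Ray p₀ q
  next  : ∀ {r q} → Ray p₀ r → IsInvPi r q → Ray p₀ q

InPrincipalRay : ℕ → Set
InPrincipalRay q = Σ ℕ λ p₀ → Cbar p₀ × Ray p₀ q

IsOrigin : ℕ → Set
IsOrigin q = Σ ℕ λ p₀ → Cbar p₀ × IsInvPi p₀ q

isOrigin? : (q : ℕ) → Dec (IsOrigin q)
isOrigin? q with (1 ≤? π q ×-dec ¬? (prime? (π q))) ×-dec prime? q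
... | yes (c , pq) = yes (π q , c , pq , refl)
... | no ¬h = no λ { (p₀ , c , pq , e) → ¬h (subst' e c , pq) }
  where
  subst' : ∀ {a b} → a ≡ b → Cbar b → Cbar a
  subst' refl c = c

nonOrigins : List ℕ → ℕ
nonOrigins xs = length (filter (λ x → ¬? (isOrigin? x)) xs)

-- Every prime lies on a principal ray because iterating π strictly decreases a prime
-- until a non-prime index is reached. For twin primes q, q + 2 > 5 the even number q + 1 is not
-- prime, so π (q + 2) = π q + 1 ≥ 4; two consecutive numbers ≥ 3 are never both prime, so
-- at least one of q, q + 2 is an origin. The constellations T₂, T₃, T₄ are built from the
-- twin pairs {p, p + 2} and {p + 6, p + 8} plus at most one further element.
module Submission where

open import Defs
open import Data.Nat using (ℕ; zero; suc; _+_; _<_; _≤_; _≤′_; ≤′-refl; ≤′-step; z≤n; s≤s)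
open import Data.Nat.Properties
  using (≤-refl; ≤-trans; ≤-reflexive; <⇒≤; <-irrefl; n≤1+n; m≤m+n; m≤n+m; +-comm; +-assoc; +-mono-≤; suc-injective; ≤⇒≤′)
open import Data.Nat.Primality using (Prime; prime?; prime⇒irreducible; ¬prime[1])
open import Data.Nat.Divisibility using (_∣_; _∣0; ∣-refl; ∣m∣n⇒∣m+n)
open import Data.Nat.Induction using (<-rec)
open import Data.Product using (_×_; _,_)
open import Data.Sum using (_⊎_; inj₁; inj₂)
open import Data.Empty using (⊥-elim)
open import Data.List using (_∷_; []; _++_; length; filter)
open import Data.List.Properties using (filter-++; filter-reject; length-++; length-filter)
open import Data.List.Relation.Unary.All as All using (All; _∷_; [])
open import Relation.Nullary using (¬_; Dec; yes; no; ¬?; contradiction)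
open import Relation.Binary.PropositionalEquality using (_≡_; refl; sym; trans; cong; subst; module ≡-Reasoning)

even∨odd : ∀ n → 2 ∣ n ⊎ 2 ∣ suc n
even∨odd zero = inj₁ (2 ∣0)
even∨odd (suc n) with even∨odd n
... | inj₁ 2∣n   = inj₂ (∣m∣n⇒∣m+n ∣-refl 2∣n)
... | inj₂ 2∣1+n = inj₁ 2∣1+n

even-prime≡2 : ∀ {p} → Prime p → 2 ∣ p → p ≡ 2
even-prime≡2 pp 2∣p with prime⇒irreducible pp 2∣p
... | inj₂ 2≡p = sym 2≡p

prime∧prime[1+n]⇒n≡2 : ∀ {n} → Prime n → Prime (suc n) → n ≡ 2
prime∧prime[1+n]⇒n≡2 {n} pn pn+1 with even∨odd n
... | inj₁ 2∣n   = even-prime≡2 pn 2∣n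
... | inj₂ 2∣1+n = contradiction (subst Prime (suc-injective (even-prime≡2 pn+1 2∣1+n)) pn) ¬prime[1]

π[1+n]≡1+π[n] : ∀ {n} → Prime (suc n) → π (suc n) ≡ suc (π n)
π[1+n]≡1+π[n] {n} pn+1 with prime? (suc n)
... | yes _    = refl
... | no ¬pn+1 = contradiction pn+1 ¬pn+1

π[1+n]≡π[n] : ∀ {n} → ¬ Prime (suc n) → π (suc n) ≡ π n
π[1+n]≡π[n] {n} ¬pn+1 with prime? (suc n)
... | yes pn+1 = contradiction pn+1 ¬pn+1
... | no _     = refl

π[n]≤π[1+n] : ∀ n → π n ≤ π (suc n)
π[n]≤π[1+n] n with prime? (suc n)
... | yes _ = n≤1+n (π n)
... | no _  = ≤-refl

π[1+n]≤1+π[n] : ∀ n → π (suc n) ≤ suc (π n)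
π[1+n]≤1+π[n] n with prime? (suc n)
... | yes _ = ≤-refl
... | no _  = n≤1+n (π n)

π[1+n]≤n : ∀ n → π (suc n) ≤ n
π[1+n]≤n zero    = z≤n
π[1+n]≤n (suc n) = ≤-trans (π[1+n]≤1+π[n] (suc n)) (s≤s (π[1+n]≤n n))

π-mono-≤ : ∀ {m n} → m ≤ n → π m ≤ π n
π-mono-≤ m≤n = mono′ (≤⇒≤′ m≤n)
  where
  mono′ : ∀ {m n} → m ≤′ n → π m ≤ π n
  mono′ ≤′-refl            = ≤-refl
  mono′ (≤′-step {n} m≤′n) = ≤-trans (mono′ m≤′n) (π[n]≤π[1+n] n)

¬prime[π]⇒isOrigin : ∀ {q} → Prime q → ¬ Prime (π q) → IsOrigin q
¬prime[π]⇒isOrigin {suc n} pq ¬pπq =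
  π (suc n) , (subst (1 ≤_) (sym (π[1+n]≡1+π[n] pq)) (s≤s z≤n) , ¬pπq) , pq , refl

isOrigin⇒inPrincipalRay : ∀ {q} → IsOrigin q → InPrincipalRay q
isOrigin⇒inPrincipalRay (p₀ , p₀∈C̄ , q≡π⁻¹[p₀]) = p₀ , p₀∈C̄ , first q≡π⁻¹[p₀]

prime⇒inPrincipalRay : ∀ {q} → Prime q → InPrincipalRay q
prime⇒inPrincipalRay {q} = <-rec (λ q → Prime q → InPrincipalRay q) descend q
  where
  descend : ∀ q → (∀ {r} → r < q → Prime r → InPrincipalRay r) → Prime q → InPrincipalRay q
  descend (suc n) rec pq with prime? (π (suc n))
  ... | no ¬pπq = isOrigin⇒inPrincipalRay (¬prime[π]⇒isOrigin pq ¬pπq)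
  ... | yes pπq with rec (s≤s (π[1+n]≤n n)) pπq
  ...   | p₀ , p₀∈C̄ , πq∈ray = p₀ , p₀∈C̄ , next πq∈ray (pq , refl)

π[q+2]≡1+π[q] : ∀ {q} → 3 ≤ q → Prime q → Prime (q + 2) → π (q + 2) ≡ suc (π q)
π[q+2]≡1+π[q] {q} 3≤q pq pq+2 = begin
  π (q + 2)       ≡⟨ cong π (+-comm q 2) ⟩
  π (suc (suc q)) ≡⟨ π[1+n]≡1+π[n] (subst Prime (+-comm q 2) pq+2) ⟩
  suc (π (suc q)) ≡⟨ cong suc (π[1+n]≡π[n] ¬pq+1) ⟩
  suc (π q)       ∎
  where
  open ≡-Reasoning
  ¬pq+1 : ¬ Prime (suc q)
  ¬pq+1 pq+1 = <-irrefl refl (subst (3 ≤_) (prime∧prime[1+n]⇒n≡2 pq pq+1) 3≤q)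

twinPrimes⇒isOrigin : ∀ {q} → 5 ≤ q → Prime q → Prime (q + 2) → IsOrigin q ⊎ IsOrigin (q + 2)
twinPrimes⇒isOrigin {q} 5≤q pq pq+2 with prime? (π q) | prime? (π (q + 2))
... | no ¬pπq | _          = inj₁ (¬prime[π]⇒isOrigin pq ¬pπq)
... | yes _   | no ¬pπq+2  = inj₂ (¬prime[π]⇒isOrigin pq+2 ¬pπq+2)
... | yes pπq | yes pπq+2 =
  ⊥-elim (<-irrefl refl (subst (3 ≤_) πq≡2 (π-mono-≤ 5≤q)))
  where
  πq≡2 : π q ≡ 2
  πq≡2 = prime∧prime[1+n]⇒n≡2 pπq (subst Prime (π[q+2]≡1+π[q] (≤-trans (m≤m+n 3 2) 5≤q) pq pq+2) pπq+2)

nonOrigin? : (x : ℕ) → Dec (¬ IsOrigin x)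
nonOrigin? x = ¬? (isOrigin? x)

nonOrigins-++ : ∀ xs ys → nonOrigins (xs ++ ys) ≡ nonOrigins xs + nonOrigins ys
nonOrigins-++ xs ys = trans (cong length (filter-++ nonOrigin? xs ys)) (length-++ (filter nonOrigin? xs))

nonOrigins-++-≤ : ∀ xs {ys m n} → nonOrigins xs ≤ m → nonOrigins ys ≤ n → nonOrigins (xs ++ ys) ≤ m + n
nonOrigins-++-≤ xs {ys} xs≤m ys≤n = ≤-trans (≤-reflexive (nonOrigins-++ xs ys)) (+-mono-≤ xs≤m ys≤n)

nonOrigins≤length : ∀ xs → nonOrigins xs ≤ length xs
nonOrigins≤length = length-filter nonOrigin?

nonOrigins[origin]≡0 : ∀ {x} → IsOrigin x → nonOrigins (x ∷ []) ≡ 0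
nonOrigins[origin]≡0 o = cong length (filter-reject nonOrigin? (λ ¬o → ¬o o))

nonOrigins-pair≤1 : ∀ {x y} → IsOrigin x ⊎ IsOrigin y → nonOrigins (x ∷ y ∷ []) ≤ 1
nonOrigins-pair≤1 {x} {y} (inj₁ ox) =
  nonOrigins-++-≤ (x ∷ []) (≤-reflexive (nonOrigins[origin]≡0 ox)) (nonOrigins≤length (y ∷ []))
nonOrigins-pair≤1 {x} {y} (inj₂ oy) =
  nonOrigins-++-≤ (x ∷ []) (nonOrigins≤length (x ∷ [])) (≤-reflexive (nonOrigins[origin]≡0 oy))

twinPrimes⇒nonOrigins≤1 : ∀ {q r} → 5 ≤ q → Prime q → Prime r → r ≡ q + 2 → nonOrigins (q ∷ r ∷ []) ≤ 1
twinPrimes⇒nonOrigins≤1 5≤q pq pr refl = nonOrigins-pair≤1 (twinPrimes⇒isOrigin 5≤q pq pr)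

theorem3 :
    (∀ p → 5 < p → Prime p → Prime (p + 2) →
      All InPrincipalRay (p ∷ p + 2 ∷ []) × nonOrigins (p ∷ p + 2 ∷ []) ≤ 1)
    × (∀ p → 5 < p → Prime p → Prime (p + 2) → Prime (p + 6) →
      All InPrincipalRay (p ∷ p + 2 ∷ p + 6 ∷ [])
        × nonOrigins (p ∷ p + 2 ∷ p + 6 ∷ []) ≤ 2)
    × (∀ p → 5 < p → Prime p → Prime (p + 2) → Prime (p + 6) → Prime (p + 8) →
      All InPrincipalRay (p ∷ p + 2 ∷ p + 6 ∷ p + 8 ∷ [])
        × nonOrigins (p ∷ p + 2 ∷ p + 6 ∷ p + 8 ∷ []) ≤ 2)
    × (∀ p → 5 < p → Prime p → Prime (p + 2) → Prime (p + 6) → Prime (p + 8) →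
        Prime (p + 12) →
      All InPrincipalRay (p ∷ p + 2 ∷ p + 6 ∷ p + 8 ∷ p + 12 ∷ [])
        × nonOrigins (p ∷ p + 2 ∷ p + 6 ∷ p + 8 ∷ p + 12 ∷ []) ≤ 3)
theorem3 =
    (λ p 5<p a b → rays (a ∷ b ∷ []) , twin₁ p 5<p a b)
  , (λ p 5<p a b c → rays (a ∷ b ∷ c ∷ []) ,
       nonOrigins-++-≤ (p ∷ p + 2 ∷ []) (twin₁ p 5<p a b) (nonOrigins≤length (p + 6 ∷ [])))
  , (λ p 5<p a b c d → rays (a ∷ b ∷ c ∷ d ∷ []) ,
       nonOrigins-++-≤ (p ∷ p + 2 ∷ []) (twin₁ p 5<p a b) (twin₂ p c d))
  , (λ p 5<p a b c d e → rays (a ∷ b ∷ c ∷ d ∷ e ∷ []) ,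
       nonOrigins-++-≤ (p ∷ p + 2 ∷ []) (twin₁ p 5<p a b)
         (nonOrigins-++-≤ (p + 6 ∷ p + 8 ∷ []) (twin₂ p c d) (nonOrigins≤length (p + 12 ∷ []))))
  where
  rays : ∀ {qs} → All Prime qs → All InPrincipalRay qs
  rays = All.map prime⇒inPrincipalRay

  twin₁ : ∀ p → 5 < p → Prime p → Prime (p + 2) → nonOrigins (p ∷ p + 2 ∷ []) ≤ 1
  twin₁ p 5<p a b = twinPrimes⇒nonOrigins≤1 (<⇒≤ 5<p) a b refl

  twin₂ : ∀ p → Prime (p + 6) → Prime (p + 8) → nonOrigins (p + 6 ∷ p + 8 ∷ []) ≤ 1
  twin₂ p c d = twinPrimes⇒nonOrigins≤1 (≤-trans (n≤1+n 5) (m≤n+m 6 p)) c d (sym (+-assoc p 6 2))
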